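{- Let $q$ be an odd prime power and let $B(\cdot,\cdot)$ be a non-degenerate bilinear form on $\mathbb{F}_q^2$. For $\mathcal{E} \subseteq \mathbb{F}_q^2$, let \[ B^{\ast}(\mathcal{E}) = \{B(\mathbf{x},\mathbf{y}) : \mathbf{x},\mathbf{y} \in \mathcal{E}\} \setminus \{0\}. \] Then \[ |B^{\ast}(\mathcal{E})| \geq q\left(1 - \frac{q + q^{3/2}}{|\mathcal{E}| + q^{3/2}}\right). \]
   Context: $\mathbb{F}_q$ denotes the finite field with $q$ elements. -}

module Defs where

open import Level using (0ℓ)
open import Data.Nat as ℕ using (ℕ; suc; _^_)
open import Data.Nat.Primality using (Prime)
open import Data.Nat.Divisibility using (_∣_)
open import Data.Integer as ℤ using (ℤ; +_)
open import Data.Fin using (Fin)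
open import Data.Fin.Properties using () renaming (_≟_ to _≟ᶠ_)
open import Data.Bool using (Bool; true; false; not; _∧_)
open import Data.List using (List; map; filterᵇ; length; allFin; cartesianProduct)
open import Data.Bool.ListAction using (any)
open import Data.Product using (_×_; _,_; ∃; ∃-syntax; proj₁; proj₂)
open import Relation.Nullary using (¬_; Dec; yes; no; does)
open import Relation.Binary.PropositionalEquality using (_≡_; refl; cong; sym; trans)
open import Algebra.Structures using (IsCommutativeRing)
open import Function.Bundles using (_↔_; Inverse)

record FiniteField (q : ℕ) : Set₁ where
  infixl 7 _*_
  infixl 6 _+_
  field
    Carrier : Set
    _+_ _*_ : Carrier → Carrier → Carrier
    -_ : Carrier → Carrier
    0# 1# : Carrier
    isCommutativeRing : IsCommutativeRing _≡_ _+_ _*_ -_ 0# 1#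
    0≢1 : ¬ (0# ≡ 1#)
    inverse : ∀ x → ¬ (x ≡ 0#) → ∃[ y ] (x * y ≡ 1#)
    enum : Carrier ↔ Fin q

  _≟_ : (x y : Carrier) → Dec (x ≡ y)
  x ≟ y with Inverse.to enum x ≟ᶠ Inverse.to enum y
  ... | yes p = yes (trans (sym (Inverse.strictlyInverseʳ enum x))
                     (trans (cong (Inverse.from enum) p) (Inverse.strictlyInverseʳ enum y)))
  ... | no ¬p = no (λ e → ¬p (cong (Inverse.to enum) e))

  _==_ : Carrier → Carrier → Bool
  x == y = does (x ≟ y)

  elements : List Carrier
  elements = map (Inverse.from enum) (allFin q)

  Vec2 : Set
  Vec2 = Carrier × Carrier

  points : List Vec2
  points = cartesianProduct elements elements

  _⊕_ : Vec2 → Vec2 → Vec2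
  (a , b) ⊕ (c , d) = (a + c , b + d)

  _·_ : Carrier → Vec2 → Vec2
  λ' · (a , b) = (λ' * a , λ' * b)

  𝟎 : Vec2
  𝟎 = (0# , 0#)

  record IsBilinear (B : Vec2 → Vec2 → Carrier) : Set where
    field
      additiveˡ : ∀ x x' y → B (x ⊕ x') y ≡ B x y + B x' y
      additiveʳ : ∀ x y y' → B x (y ⊕ y') ≡ B x y + B x y'
      homogeneousˡ : ∀ a x y → B (a · x) y ≡ a * B x y
      homogeneousʳ : ∀ a x y → B x (a · y) ≡ a * B x y

  record IsNonDegenerate (B : Vec2 → Vec2 → Carrier) : Set where
    field
      left  : ∀ x → (∀ y → B x y ≡ 0#) → x ≡ 𝟎
      right : ∀ y → (∀ x → B x y ≡ 0#) → y ≡ 𝟎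

  card : (Vec2 → Bool) → ℕ
  card E = length (filterᵇ (λ x → E x) points)

  -- |B*(E)| = |{B(x,y) : x,y ∈ E} \ {0}|
  cardBstar : (Vec2 → Vec2 → Carrier) → (Vec2 → Bool) → ℕ
  cardBstar B E = length (filterᵇ (λ c → not (c == 0#) ∧
      any (λ x → any (λ y → E x ∧ E y ∧ (B x y == c)) points) points) elements)

OddPrimePower : ℕ → Set
OddPrimePower q = (∃[ p ] ∃[ k ] (Prime p × q ≡ p ^ suc k)) × ¬ (2 ∣ q)

module Submission where

-- Write E* = E ∖ {0}, e* = |E*| and ν(t) = #{(x, y) ∈ E* × E* : B(x, y) = t}.
-- Non-degeneracy makes {x : B(x, y) = t} a line of q points for y ≠ 0, and
-- two such lines for y ≠ y', t ≠ 0 meet at most once.  Hence, for t ≠ 0 and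
-- a_t(x) = #{y ∈ E* : B(x, y) = t}, we have Σ_x a_t(x) = q e* and
-- Σ_x a_t(x)² ≤ e*² + (q - 1) e*, and Cauchy–Schwarz over E* gives
-- (q ν(t) - e*²)² ≤ q³ e*².  Summing over t ∈ B*(E), where all pairs of
-- nonzero value live, D = Σ (q ν(t) - e*²) = q (e*² - ν(0)) - e*² |B*(E)|,
-- and Cauchy–Schwarz over B*(E) gives D² ≤ |B*(E)|² q³ e*²; moreover
-- ν(0) ≤ e* (q - 1) since a line through the origin has q - 1 other points.
-- Since e* ≤ |E| ≤ e* + 1, integer arithmetic yields the claim.

open import Defs
open import Level using (0ℓ)
open import Data.Nat as ℕ using (ℕ; zero; suc)
open import Data.Integer as Int using (ℤ; +_; +[1+_]; -[1+_]; 0ℤ; 1ℤ; +≤+)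
import Data.Integer.Properties as ℤP
open import Data.Integer.Tactic.RingSolver using (solve-∀)
open import Data.Bool using (Bool; true; false; not; _∧_)
import Data.Bool.Properties as BoolP
open import Data.List using (List; []; _∷_; _++_; map; filterᵇ; length; allFin; cartesianProduct)
import Data.List.Properties as ListP
open import Data.Bool.ListAction using (any)
open import Data.Fin using (Fin) renaming (zero to fzero; suc to fsuc)
import Data.Fin.Properties as FinP
open import Data.Product using (_×_; _,_; proj₁; proj₂; ∃-syntax)
open import Data.Product.Properties using (,-injective)
open import Data.Sum using (_⊎_; inj₁; inj₂)
open import Data.Empty using (⊥-elim)
open import Function.Bundles using (Inverse; _⇔_; mk⇔; Equivalence)
import Function.Properties.Equivalence as ⇔
open import Relation.Nullary using (¬_; Dec; yes; no; does)
open import Relation.Nullary.Decidable using (dec-true; dec-false; does-⇔; map′; _×-dec_)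
open import Relation.Binary.Definitions using (DecidableEquality)
open import Relation.Binary.PropositionalEquality
open import Algebra.Bundles using (CommutativeRing)
import Algebra.Solver.Ring.NaturalCoefficients.Default as SemiringSolver

module IntegerFacts where
  open Int using (_*_; _≤_)

  *-monoˡ-nonneg : ∀ {c a b} → 0ℤ ≤ c → a ≤ b → c * a ≤ c * b
  *-monoˡ-nonneg {c} 0≤c = ℤP.*-monoˡ-≤-nonNeg c {{Int.nonNegative 0≤c}}

  *-monoʳ-nonneg : ∀ {c a b} → 0ℤ ≤ c → a ≤ b → a * c ≤ b * c
  *-monoʳ-nonneg {c} 0≤c = ℤP.*-monoʳ-≤-nonNeg c {{Int.nonNegative 0≤c}}

  *-nonneg : ∀ {a b} → 0ℤ ≤ a → 0ℤ ≤ b → 0ℤ ≤ a * b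
  *-nonneg {a} {b} 0≤a 0≤b = subst (_≤ a * b) (ℤP.*-zeroʳ a) (*-monoˡ-nonneg 0≤a 0≤b)

  square-nonneg : ∀ z → 0ℤ ≤ z * z
  square-nonneg (+ zero) = +≤+ ℕ.z≤n
  square-nonneg +[1+ n ] = +≤+ ℕ.z≤n
  square-nonneg -[1+ n ] = +≤+ ℕ.z≤n

  square-mono : ∀ {a b} → 0ℤ ≤ a → a ≤ b → a * a ≤ b * b
  square-mono {a} {b} 0≤a a≤b =
    ℤP.≤-trans (*-monoˡ-nonneg 0≤a a≤b) (*-monoʳ-nonneg (ℤP.≤-trans 0≤a a≤b) a≤b)

module Sums where
  open Int using (_+_; _*_; _-_; -_; _≤_)

  ⟦_⟧ : Bool → ℤ
  ⟦ true ⟧ = 1ℤ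
  ⟦ false ⟧ = 0ℤ

  ⟦∧⟧ : ∀ a b → ⟦ a ∧ b ⟧ ≡ ⟦ a ⟧ * ⟦ b ⟧
  ⟦∧⟧ true b = sym (ℤP.*-identityˡ ⟦ b ⟧)
  ⟦∧⟧ false b = refl

  ⟦not⟧ : ∀ b → ⟦ not b ⟧ ≡ 1ℤ - ⟦ b ⟧
  ⟦not⟧ true = refl
  ⟦not⟧ false = refl

  ⟦⟧-nonneg : ∀ b → 0ℤ ≤ ⟦ b ⟧
  ⟦⟧-nonneg true = +≤+ ℕ.z≤n
  ⟦⟧-nonneg false = +≤+ ℕ.z≤n

  ⟦⟧-idempotent : ∀ b → ⟦ b ⟧ * ⟦ b ⟧ ≡ ⟦ b ⟧
  ⟦⟧-idempotent true = refl
  ⟦⟧-idempotent false = refl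

  ⟦∧⟧-≤ʳ : ∀ a b → ⟦ a ∧ b ⟧ ≤ ⟦ b ⟧
  ⟦∧⟧-≤ʳ true b = ℤP.≤-refl
  ⟦∧⟧-≤ʳ false b = ⟦⟧-nonneg b

  ⟦⟧-guard-≡ : ∀ b {m n} → (b ≡ true → m ≡ n) → ⟦ b ⟧ * m ≡ ⟦ b ⟧ * n
  ⟦⟧-guard-≡ true h = cong (1ℤ *_) (h refl)
  ⟦⟧-guard-≡ false h = refl

  ⟦⟧-guard-≤ : ∀ b {m n} → (b ≡ true → m ≤ n) → ⟦ b ⟧ * m ≤ ⟦ b ⟧ * n
  ⟦⟧-guard-≤ true {m} {n} h = subst₂ _≤_ (sym (ℤP.*-identityˡ m)) (sym (ℤP.*-identityˡ n)) (h refl)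
  ⟦⟧-guard-≤ false h = ℤP.≤-refl

  ⟦⟧-weaken : ∀ b {v} → 0ℤ ≤ v → ⟦ b ⟧ * v ≤ v
  ⟦⟧-weaken true {v} _ = ℤP.≤-reflexive (ℤP.*-identityˡ v)
  ⟦⟧-weaken false 0≤v = 0≤v

  decided : ∀ {P : Set} (d : Dec P) → does d ≡ true → P
  decided (yes p) _ = p

  ⟦≟⟧-sym : ∀ {A : Set} (_≟_ : DecidableEquality A) x y → ⟦ does (x ≟ y) ⟧ ≡ ⟦ does (y ≟ x) ⟧
  ⟦≟⟧-sym _≟_ x y = cong ⟦_⟧ (does-⇔ (mk⇔ sym sym) (x ≟ y) (y ≟ x))

  ∑ : {A : Set} → List A → (A → ℤ) → ℤ
  ∑ [] f = 0ℤ
  ∑ (x ∷ xs) f = f x + ∑ xs f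

  syntax ∑ L (λ x → f) = ∑[ x ∈ L ] f

  module _ {A : Set} where

    ∑-cong : ∀ (L : List A) {f g : A → ℤ} → (∀ x → f x ≡ g x) → ∑ L f ≡ ∑ L g
    ∑-cong [] eq = refl
    ∑-cong (x ∷ L) eq = cong₂ _+_ (eq x) (∑-cong L eq)

    ∑-+ : ∀ (L : List A) (f g : A → ℤ) → ∑[ x ∈ L ] (f x + g x) ≡ ∑ L f + ∑ L g
    ∑-+ [] f g = refl
    ∑-+ (x ∷ L) f g rewrite ∑-+ L f g = interchange (f x) (g x) (∑ L f) (∑ L g)
      where interchange : ∀ a b c d → a + b + (c + d) ≡ a + c + (b + d)
            interchange = solve-∀

    ∑-- : ∀ (L : List A) (f g : A → ℤ) → ∑[ x ∈ L ] (f x - g x) ≡ ∑ L f - ∑ L g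
    ∑-- [] f g = refl
    ∑-- (x ∷ L) f g rewrite ∑-- L f g = interchange (f x) (g x) (∑ L f) (∑ L g)
      where interchange : ∀ a b c d → a - b + (c - d) ≡ a + c - (b + d)
            interchange = solve-∀

    ∑-*ˡ : ∀ (L : List A) (c : ℤ) (f : A → ℤ) → ∑[ x ∈ L ] (c * f x) ≡ c * ∑ L f
    ∑-*ˡ [] c f = sym (ℤP.*-zeroʳ c)
    ∑-*ˡ (x ∷ L) c f rewrite ∑-*ˡ L c f = sym (ℤP.*-distribˡ-+ c (f x) (∑ L f))

    ∑-*ʳ : ∀ (L : List A) (c : ℤ) (f : A → ℤ) → ∑[ x ∈ L ] (f x * c) ≡ ∑ L f * c
    ∑-*ʳ L c f = begin
        ∑[ x ∈ L ] (f x * c) ≡⟨ ∑-cong L (λ x → ℤP.*-comm (f x) c) ⟩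
        ∑[ x ∈ L ] (c * f x) ≡⟨ ∑-*ˡ L c f ⟩
        c * ∑ L f            ≡⟨ ℤP.*-comm c (∑ L f) ⟩
        ∑ L f * c            ∎
      where open ≡-Reasoning

    ∑-const : ∀ (L : List A) (c : ℤ) → ∑ L (λ _ → c) ≡ + length L * c
    ∑-const [] c = refl
    ∑-const (x ∷ L) c rewrite ∑-const L c = one-more c (+ length L)
      where one-more : ∀ c n → c + n * c ≡ (1ℤ + n) * c
            one-more = solve-∀

    ∑-zero : ∀ (L : List A) → ∑ L (λ _ → 0ℤ) ≡ 0ℤ
    ∑-zero [] = refl
    ∑-zero (x ∷ L) = trans (ℤP.+-identityˡ _) (∑-zero L)

    ∑-++ : ∀ (L M : List A) (f : A → ℤ) → ∑ (L ++ M) f ≡ ∑ L f + ∑ M f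
    ∑-++ [] M f = sym (ℤP.+-identityˡ _)
    ∑-++ (x ∷ L) M f rewrite ∑-++ L M f = sym (ℤP.+-assoc (f x) (∑ L f) (∑ M f))

    ∑-mono : ∀ (L : List A) {f g : A → ℤ} → (∀ x → f x ≤ g x) → ∑ L f ≤ ∑ L g
    ∑-mono [] h = ℤP.≤-refl
    ∑-mono (x ∷ L) h = ℤP.+-mono-≤ (h x) (∑-mono L h)

    ∑-nonneg : ∀ (L : List A) {f : A → ℤ} → (∀ x → 0ℤ ≤ f x) → 0ℤ ≤ ∑ L f
    ∑-nonneg [] h = ℤP.≤-refl
    ∑-nonneg (x ∷ L) h = ℤP.+-mono-≤ (h x) (∑-nonneg L h)

    ∑-vanishes : ∀ (L : List A) (p : A → Bool) (f : A → ℤ) → any p L ≡ false →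
                 (∀ x → p x ≡ false → f x ≡ 0ℤ) → ∑ L f ≡ 0ℤ
    ∑-vanishes [] p f none h = refl
    ∑-vanishes (x ∷ L) p f none h with p x in px
    ... | false = trans (cong (_+ ∑ L f) (h x px)) (trans (ℤP.+-identityˡ _) (∑-vanishes L p f none h))

    ∑-filter : ∀ (L : List A) (p : A → Bool) (g : A → ℤ) → ∑[ x ∈ L ] (⟦ p x ⟧ * g x) ≡ ∑ (filterᵇ p L) g
    ∑-filter [] p g = refl
    ∑-filter (x ∷ L) p g with p x
    ... | true = cong₂ _+_ (ℤP.*-identityˡ (g x)) (∑-filter L p g)
    ... | false = trans (ℤP.+-identityˡ _) (∑-filter L p g)

    length-filter : ∀ (L : List A) (p : A → Bool) → + length (filterᵇ p L) ≡ ∑[ x ∈ L ] ⟦ p x ⟧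
    length-filter [] p = refl
    length-filter (x ∷ L) p with p x
    ... | true = trans (ℤP.pos-+ 1 (length (filterᵇ p L))) (cong (λ z → 1ℤ + z) (length-filter L p))
    ... | false = trans (length-filter L p) (sym (ℤP.+-identityˡ _))

    ∑-product : ∀ (L : List A) (f g : A → ℤ) → ∑ L f * ∑ L g ≡ ∑[ x ∈ L ] ∑[ y ∈ L ] (f x * g y)
    ∑-product L f g = begin
        ∑ L f * ∑ L g                         ≡⟨ sym (∑-*ʳ L (∑ L g) f) ⟩
        ∑[ x ∈ L ] (f x * ∑ L g)              ≡⟨ ∑-cong L (λ x → sym (∑-*ˡ L (f x) g)) ⟩
        ∑[ x ∈ L ] ∑[ y ∈ L ] (f x * g y)     ∎
      where open ≡-Reasoning

    sift : (_≟_ : DecidableEquality A) (L : List A) (c : A) (g : A → ℤ) →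
           ∑[ x ∈ L ] ⟦ does (x ≟ c) ⟧ ≡ 1ℤ → ∑[ x ∈ L ] (⟦ does (x ≟ c) ⟧ * g x) ≡ g c
    sift _≟_ L c g once = begin
        ∑[ x ∈ L ] (⟦ does (x ≟ c) ⟧ * g x)   ≡⟨ ∑-cong L at-c ⟩
        ∑[ x ∈ L ] (g c * ⟦ does (x ≟ c) ⟧)   ≡⟨ ∑-*ˡ L (g c) _ ⟩
        g c * ∑[ x ∈ L ] ⟦ does (x ≟ c) ⟧     ≡⟨ cong (g c *_) once ⟩
        g c * 1ℤ                               ≡⟨ ℤP.*-identityʳ (g c) ⟩
        g c                                    ∎
      where
        open ≡-Reasoning
        at-c : ∀ x → ⟦ does (x ≟ c) ⟧ * g x ≡ g c * ⟦ does (x ≟ c) ⟧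
        at-c x with x ≟ c
        ... | yes refl = ℤP.*-comm 1ℤ (g x)
        ... | no _ = sym (ℤP.*-zeroʳ (g c))

    ∑-square-expand : ∀ (L : List A) (c m : ℤ) (f : A → ℤ) →
      ∑[ x ∈ L ] ((c * f x - m) * (c * f x - m))
        ≡ (c * c) * ∑[ x ∈ L ] (f x * f x) - ((c + c) * m) * ∑ L f + ∑ L (λ _ → m * m)
    ∑-square-expand L c m f = begin
        ∑[ x ∈ L ] ((c * f x - m) * (c * f x - m))
      ≡⟨ ∑-cong L (λ x → expand c m (f x)) ⟩
        ∑[ x ∈ L ] ((c * c) * (f x * f x) - ((c + c) * m) * f x + m * m)
      ≡⟨ ∑-+ L _ _ ⟩
        ∑[ x ∈ L ] ((c * c) * (f x * f x) - ((c + c) * m) * f x) + ∑ L (λ _ → m * m)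
      ≡⟨ cong (_+ ∑ L (λ _ → m * m)) (∑-- L _ _) ⟩
        ∑[ x ∈ L ] ((c * c) * (f x * f x)) - ∑[ x ∈ L ] (((c + c) * m) * f x) + ∑ L (λ _ → m * m)
      ≡⟨ cong (λ s → s + ∑ L (λ _ → m * m)) (cong₂ _-_ (∑-*ˡ L (c * c) _) (∑-*ˡ L ((c + c) * m) f)) ⟩
        (c * c) * ∑[ x ∈ L ] (f x * f x) - ((c + c) * m) * ∑ L f + ∑ L (λ _ → m * m)
      ∎
      where
        open ≡-Reasoning
        expand : ∀ c m z → (c * z - m) * (c * z - m) ≡ (c * c) * (z * z) - ((c + c) * m) * z + m * m
        expand = solve-∀

    -- Cauchy–Schwarz: (Σ f)² ≤ |L| · Σ f².  Adding a term a to L increases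
    -- the gap by Σ_{x ∈ L} (f a - f x)² ≥ 0; that square is written as
    -- ((-1) f x - (-f a))² to apply ∑-square-expand.
    cauchy-schwarz : ∀ (L : List A) (f : A → ℤ) → ∑ L f * ∑ L f ≤ + length L * ∑[ x ∈ L ] (f x * f x)
    cauchy-schwarz [] f = ℤP.≤-refl
    cauchy-schwarz (a ∷ L) f =
      ℤP.0≤i-j⇒j≤i (subst (0ℤ ≤_) (sym gap)
        (ℤP.+-mono-≤ (ℤP.i≤j⇒0≤j-i (cauchy-schwarz L f))
                     (∑-nonneg L (λ x → IntegerFacts.square-nonneg (- 1ℤ * f x - - f a)))))
      where
        n = + length L
        S = ∑ L f
        T = ∑[ x ∈ L ] (f x * f x)
        gap : (1ℤ + n) * (f a * f a + T) - (f a + S) * (f a + S)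
              ≡ (n * T - S * S) + ∑[ x ∈ L ] ((- 1ℤ * f x - - f a) * (- 1ℤ * f x - - f a))
        gap rewrite ∑-square-expand L (- 1ℤ) (- f a) f | ∑-const L (- f a * - f a) = identity (f a) n S T
          where identity : ∀ a n s t → (1ℤ + n) * (a * a + t) - (a + s) * (a + s)
                             ≡ (n * t - s * s) + ((- 1ℤ * - 1ℤ) * t - ((- 1ℤ + - 1ℤ) * - a) * s + n * (- a * - a))
                identity = solve-∀

    cauchy-schwarz-on : ∀ (L : List A) (p : A → Bool) (f : A → ℤ) →
      ∑[ x ∈ L ] (⟦ p x ⟧ * f x) * ∑[ x ∈ L ] (⟦ p x ⟧ * f x)
        ≤ ∑[ x ∈ L ] ⟦ p x ⟧ * ∑[ x ∈ L ] (⟦ p x ⟧ * (f x * f x))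
    cauchy-schwarz-on L p f
      rewrite ∑-filter L p f | ∑-filter L p (λ x → f x * f x) | sym (length-filter L p)
      = cauchy-schwarz (filterᵇ p L) f

  ∑-map : ∀ {A B : Set} (L : List A) (h : A → B) (f : B → ℤ) → ∑ (map h L) f ≡ ∑[ x ∈ L ] f (h x)
  ∑-map [] h f = refl
  ∑-map (x ∷ L) h f = cong (λ z → f (h x) + z) (∑-map L h f)

  module _ {A B : Set} where

    ∑-swap : ∀ (L : List A) (M : List B) (f : A → B → ℤ) →
             ∑[ x ∈ L ] ∑[ y ∈ M ] f x y ≡ ∑[ y ∈ M ] ∑[ x ∈ L ] f x y
    ∑-swap [] M f = sym (∑-zero M)
    ∑-swap (x ∷ L) M f rewrite ∑-swap L M f = sym (∑-+ M (f x) (λ y → ∑[ x ∈ L ] f x y))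

    ∑-cartesian : ∀ (L : List A) (M : List B) (f : A × B → ℤ) →
                  ∑ (cartesianProduct L M) f ≡ ∑[ a ∈ L ] ∑[ b ∈ M ] f (a , b)
    ∑-cartesian [] M f = refl
    ∑-cartesian (x ∷ L) M f =
      trans (∑-++ (map (x ,_) M) _ f) (cong₂ _+_ (∑-map M (x ,_) f) (∑-cartesian L M f))

  ∑-allFin-suc : ∀ n (h : Fin (suc n) → ℤ) → ∑ (allFin (suc n)) h ≡ h fzero + ∑[ i ∈ allFin n ] h (fsuc i)
  ∑-allFin-suc n h = cong (λ z → h fzero + z)
    (trans (cong (λ L → ∑ L h) (sym (ListP.map-tabulate (λ i → i) fsuc))) (∑-map (allFin n) fsuc h))

  allFin-once : ∀ n (j : Fin n) → ∑[ i ∈ allFin n ] ⟦ does (i FinP.≟ j) ⟧ ≡ 1ℤ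
  allFin-once (suc n) fzero =
    trans (∑-allFin-suc n (λ i → ⟦ does (i FinP.≟ fzero) ⟧)) (cong (λ z → 1ℤ + z) (∑-zero (allFin n)))
  allFin-once (suc n) (fsuc j) =
    trans (∑-allFin-suc n (λ i → ⟦ does (i FinP.≟ fsuc j) ⟧)) (trans (ℤP.+-identityˡ _) (allFin-once n j))

  any-witness : ∀ {A : Set} (p : A → Bool) (L : List A) → any p L ≡ true → ∃[ x ] (p x ≡ true)
  any-witness p (x ∷ L) found with p x in px
  ... | true = x , px
  ... | false = any-witness p L found

module Enumeration {q : ℕ} (F : FiniteField q) where
  open Int using (_*_; _≤_)
  open Sums
  open FiniteField F using (Vec2; _≟_; _==_; enum; elements; points)
  open Inverse enum using (to; from; strictlyInverseˡ; strictlyInverseʳ)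

  _≟v_ : DecidableEquality Vec2
  (a , b) ≟v (c , d) = map′ (λ (a≡c , b≡d) → cong₂ _,_ a≡c b≡d) ,-injective (a ≟ c ×-dec b ≟ d)

  _==v_ : Vec2 → Vec2 → Bool
  x ==v y = does (x ≟v y)

  elements-once : ∀ c → ∑[ b ∈ elements ] ⟦ b == c ⟧ ≡ 1ℤ
  elements-once c = begin
      ∑[ b ∈ elements ] ⟦ b == c ⟧
    ≡⟨ ∑-map (allFin q) from (λ b → ⟦ b == c ⟧) ⟩
      ∑[ i ∈ allFin q ] ⟦ from i == c ⟧
    ≡⟨ ∑-cong (allFin q) (λ i → cong ⟦_⟧ (does-⇔ (mk⇔ (to-index i) (from-index i)) (from i ≟ c) (i FinP.≟ to c))) ⟩
      ∑[ i ∈ allFin q ] ⟦ does (i FinP.≟ to c) ⟧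
    ≡⟨ allFin-once q (to c) ⟩
      1ℤ ∎
    where
      open ≡-Reasoning
      to-index : ∀ i → from i ≡ c → i ≡ to c
      to-index i e = trans (sym (strictlyInverseˡ i)) (cong to e)
      from-index : ∀ i → i ≡ to c → from i ≡ c
      from-index i e = trans (cong from e) (strictlyInverseʳ c)

  elements-once′ : ∀ c → ∑[ t ∈ elements ] ⟦ c == t ⟧ ≡ 1ℤ
  elements-once′ c = trans (∑-cong elements (λ t → ⟦≟⟧-sym _≟_ c t)) (elements-once c)

  points-once : ∀ v → ∑[ x ∈ points ] ⟦ x ==v v ⟧ ≡ 1ℤ
  points-once (c , d) = begin
      ∑[ x ∈ points ] ⟦ x ==v (c , d) ⟧
    ≡⟨ ∑-cartesian elements elements (λ x → ⟦ x ==v (c , d) ⟧) ⟩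
      ∑[ a ∈ elements ] ∑[ b ∈ elements ] ⟦ (a == c) ∧ (b == d) ⟧
    ≡⟨ ∑-cong elements (λ a → trans (∑-cong elements (λ b → ⟦∧⟧ (a == c) (b == d))) (∑-*ˡ elements ⟦ a == c ⟧ _)) ⟩
      ∑[ a ∈ elements ] (⟦ a == c ⟧ * ∑[ b ∈ elements ] ⟦ b == d ⟧)
    ≡⟨ ∑-cong elements (λ a → trans (cong (⟦ a == c ⟧ *_) (elements-once d)) (ℤP.*-identityʳ _)) ⟩
      ∑[ a ∈ elements ] ⟦ a == c ⟧
    ≡⟨ elements-once c ⟩
      1ℤ ∎
    where open ≡-Reasoning

  ∑-elements-const : ∀ c → ∑ elements (λ _ → c) ≡ + q * c
  ∑-elements-const c = trans (∑-const elements c) (cong (λ n → + n * c) elements-length)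
    where
      elements-length : length elements ≡ q
      elements-length = trans (ListP.length-map from (allFin q)) (ListP.length-tabulate (λ i → i))

  ∑-points-const : ∀ c → ∑ points (λ _ → c) ≡ + q * (+ q * c)
  ∑-points-const c = begin
      ∑ points (λ _ → c)                          ≡⟨ ∑-cartesian elements elements (λ _ → c) ⟩
      ∑[ a ∈ elements ] ∑ elements (λ _ → c)      ≡⟨ ∑-cong elements (λ _ → ∑-elements-const c) ⟩
      ∑ elements (λ _ → + q * c)                  ≡⟨ ∑-elements-const (+ q * c) ⟩
      + q * (+ q * c)                             ∎
    where open ≡-Reasoning

  at-most-one : ∀ (p : Vec2 → Bool) → (∀ x x' → p x ≡ true → p x' ≡ true → x ≡ x') →
                ∑[ x ∈ points ] ⟦ p x ⟧ ≤ 1ℤ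
  at-most-one p unique with any p points in found
  ... | false = ℤP.≤-trans (ℤP.≤-reflexive (∑-vanishes points p (λ x → ⟦ p x ⟧) found (λ x px → cong ⟦_⟧ px)))
                           (+≤+ ℕ.z≤n)
  ... | true with any-witness p points found
  ... | x₀ , px₀ = ℤP.≤-trans (∑-mono points below-x₀) (ℤP.≤-reflexive (points-once x₀))
    where
      below-x₀ : ∀ x → ⟦ p x ⟧ ≤ ⟦ x ==v x₀ ⟧
      below-x₀ x with p x in px
      ... | false = ⟦⟧-nonneg _
      ... | true rewrite dec-true (x ≟v x₀) (unique x x₀ px px₀) = ℤP.≤-refl

module FieldAlgebra {q : ℕ} (F : FiniteField q) where
  open FiniteField F

  commutativeRing : CommutativeRing 0ℓ 0ℓ
  commutativeRing = record { isCommutativeRing = isCommutativeRing }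

  open CommutativeRing commutativeRing
    using (+-identityˡ; +-identityʳ; *-identityˡ; zeroˡ; -‿inverseʳ; *-comm)
  open SemiringSolver (CommutativeRing.commutativeSemiring commutativeRing) using (solve; _:+_; _:*_; _:=_)
  open import Algebra.Properties.Ring (CommutativeRing.ring commutativeRing) using (-‿distribˡ-*)
  open import Algebra.Properties.AbelianGroup (CommutativeRing.+-abelianGroup commutativeRing) using (⁻¹-∙-comm)
  open ≡-Reasoning

  unit-cancel : ∀ {k k⁻¹} → k * k⁻¹ ≡ 1# → ∀ c → k⁻¹ * (k * c) ≡ c
  unit-cancel {k} {k⁻¹} kk⁻¹≡1 c = begin
      k⁻¹ * (k * c) ≡⟨ solve 3 (λ k k' c → k' :* (k :* c) := k :* k' :* c) refl k k⁻¹ c ⟩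
      k * k⁻¹ * c   ≡⟨ cong (_* c) kk⁻¹≡1 ⟩
      1# * c        ≡⟨ *-identityˡ c ⟩
      c             ∎

  *-cancelˡ-nonzero : ∀ k {a b} → ¬ k ≡ 0# → k * a ≡ k * b → a ≡ b
  *-cancelˡ-nonzero k {a} {b} k≢0 ka≡kb with inverse k k≢0
  ... | k⁻¹ , kk⁻¹≡1 = begin
      a             ≡⟨ sym (unit-cancel kk⁻¹≡1 a) ⟩
      k⁻¹ * (k * a) ≡⟨ cong (k⁻¹ *_) ka≡kb ⟩
      k⁻¹ * (k * b) ≡⟨ unit-cancel kk⁻¹≡1 b ⟩
      b             ∎

  scale-equation : ∀ {β β⁻¹} → β * β⁻¹ ≡ 1# → ∀ b t → (b * β ≡ t) ⇔ (b ≡ β⁻¹ * t)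
  scale-equation {β} {β⁻¹} ββ⁻¹≡1 b t = mk⇔
    (λ bβ≡t → trans (sym (unit-cancel ββ⁻¹≡1 b)) (cong (β⁻¹ *_) (trans (*-comm β b) bβ≡t)))
    (λ b≡β⁻¹t → trans (cong (_* β) b≡β⁻¹t) (trans (*-comm (β⁻¹ * t) β) (unit-cancel (trans (*-comm β⁻¹ β) ββ⁻¹≡1) t)))

  shift-equation : ∀ s v t → (s + v ≡ t) ⇔ (v ≡ t + - s)
  shift-equation s v t = mk⇔
    (λ { refl → sym (begin
        (s + v) + - s ≡⟨ solve 3 (λ s v s' → (s :+ v) :+ s' := v :+ (s :+ s')) refl s v (- s) ⟩
        v + (s + - s) ≡⟨ cong (λ z → v + z) (-‿inverseʳ s) ⟩
        v + 0#        ≡⟨ +-identityʳ v ⟩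
        v             ∎) })
    (λ { refl → begin
        s + (t + - s) ≡⟨ solve 3 (λ s t s' → s :+ (t :+ s') := t :+ (s :+ s')) refl s t (- s) ⟩
        t + (s + - s) ≡⟨ cong (λ z → t + z) (-‿inverseʳ s) ⟩
        t + 0#        ≡⟨ +-identityʳ t ⟩
        t             ∎ })

  difference-zero : ∀ {a b} → a + - b ≡ 0# → a ≡ b
  difference-zero {a} {b} a-b≡0 =
    sym (trans (sym (+-identityʳ b)) (Equivalence.from (shift-equation b 0# a) (sym a-b≡0)))

  difference-linear : ∀ x₁ x₂ x₁' x₂' a b →
    (x₁ + - x₁') * a + (x₂ + - x₂') * b ≡ (x₁ * a + x₂ * b) + - (x₁' * a + x₂' * b)
  difference-linear x₁ x₂ x₁' x₂' a b = begin
      (x₁ + - x₁') * a + (x₂ + - x₂') * b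
    ≡⟨ solve 6 (λ x₁ x₂ y₁ y₂ a b → (x₁ :+ y₁) :* a :+ (x₂ :+ y₂) :* b := (x₁ :* a :+ x₂ :* b) :+ (y₁ :* a :+ y₂ :* b))
         refl x₁ x₂ (- x₁') (- x₂') a b ⟩
      (x₁ * a + x₂ * b) + ((- x₁') * a + (- x₂') * b)
    ≡⟨ cong (λ z → (x₁ * a + x₂ * b) + z) (trans (cong₂ _+_ (sym (-‿distribˡ-* x₁' a)) (sym (-‿distribˡ-* x₂' b)))
                                          (⁻¹-∙-comm (x₁' * a) (x₂' * b))) ⟩
      (x₁ * a + x₂ * b) + - (x₁' * a + x₂' * b)
    ∎

  determinant-zero : ∀ {u₁ u₂} a b c d → u₁ * a + u₂ * b ≡ 0# → u₁ * c + u₂ * d ≡ 0# →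
                     ¬ (u₁ ≡ 0# × u₂ ≡ 0#) → b * c ≡ a * d
  determinant-zero {u₁} {u₂} a b c d ⊥₁ ⊥₂ u≢0 with u₁ ≟ 0# | u₂ ≟ 0#
  ... | yes u₁≡0 | yes u₂≡0 = ⊥-elim (u≢0 (u₁≡0 , u₂≡0))
  ... | no u₁≢0 | _ = *-cancelˡ-nonzero u₁ u₁≢0 (begin
      u₁ * (b * c)                           ≡⟨ sym (+-identityˡ _) ⟩
      0# + u₁ * (b * c)                      ≡⟨ cong (_+ u₁ * (b * c)) (sym (trans (cong (_* d) ⊥₁) (zeroˡ d))) ⟩
      (u₁ * a + u₂ * b) * d + u₁ * (b * c)
        ≡⟨ solve 6 (λ u₁ u₂ a b c d → (u₁ :* a :+ u₂ :* b) :* d :+ u₁ :* (b :* c)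
                                     := (u₁ :* c :+ u₂ :* d) :* b :+ u₁ :* (a :* d)) refl u₁ u₂ a b c d ⟩
      (u₁ * c + u₂ * d) * b + u₁ * (a * d)   ≡⟨ cong (_+ u₁ * (a * d)) (trans (cong (_* b) ⊥₂) (zeroˡ b)) ⟩
      0# + u₁ * (a * d)                      ≡⟨ +-identityˡ _ ⟩
      u₁ * (a * d)                           ∎)
  ... | yes _ | no u₂≢0 = sym (*-cancelˡ-nonzero u₂ u₂≢0 (begin
      u₂ * (a * d)                           ≡⟨ sym (+-identityˡ _) ⟩
      0# + u₂ * (a * d)                      ≡⟨ cong (_+ u₂ * (a * d)) (sym (trans (cong (_* c) ⊥₁) (zeroˡ c))) ⟩
      (u₁ * a + u₂ * b) * c + u₂ * (a * d)
        ≡⟨ solve 6 (λ u₁ u₂ a b c d → (u₁ :* a :+ u₂ :* b) :* c :+ u₂ :* (a :* d)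
                                     := (u₁ :* c :+ u₂ :* d) :* a :+ u₂ :* (b :* c)) refl u₁ u₂ a b c d ⟩
      (u₁ * c + u₂ * d) * a + u₂ * (b * c)   ≡⟨ cong (_+ u₂ * (b * c)) (trans (cong (_* a) ⊥₂) (zeroˡ a)) ⟩
      0# + u₂ * (b * c)                      ≡⟨ +-identityˡ _ ⟩
      u₂ * (b * c)                           ∎))

  equal-forms : ∀ {x₁ x₂ t} a b c d → b * c ≡ a * d → ¬ t ≡ 0# →
                x₁ * a + x₂ * b ≡ t → x₁ * c + x₂ * d ≡ t → a ≡ c × b ≡ d
  equal-forms {x₁} {x₂} {t} a b c d det t≢0 at-ab at-cd =
    sym (*-cancelˡ-nonzero t t≢0 tc≡ta) , sym (*-cancelˡ-nonzero t t≢0 td≡tb)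
    where
      tc≡ta : t * c ≡ t * a
      tc≡ta = begin
          t * c                          ≡⟨ cong (_* c) (sym at-ab) ⟩
          (x₁ * a + x₂ * b) * c
            ≡⟨ solve 5 (λ x₁ x₂ a b c → (x₁ :* a :+ x₂ :* b) :* c := x₁ :* (a :* c) :+ x₂ :* (b :* c)) refl x₁ x₂ a b c ⟩
          x₁ * (a * c) + x₂ * (b * c)    ≡⟨ cong (λ z → x₁ * (a * c) + x₂ * z) det ⟩
          x₁ * (a * c) + x₂ * (a * d)
            ≡⟨ solve 5 (λ x₁ x₂ a c d → x₁ :* (a :* c) :+ x₂ :* (a :* d) := a :* (x₁ :* c :+ x₂ :* d)) refl x₁ x₂ a c d ⟩
          a * (x₁ * c + x₂ * d)          ≡⟨ cong (a *_) at-cd ⟩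
          a * t                          ≡⟨ *-comm a t ⟩
          t * a                          ∎
      td≡tb : t * d ≡ t * b
      td≡tb = begin
          t * d                          ≡⟨ cong (_* d) (sym at-ab) ⟩
          (x₁ * a + x₂ * b) * d
            ≡⟨ solve 5 (λ x₁ x₂ a b d → (x₁ :* a :+ x₂ :* b) :* d := x₁ :* (a :* d) :+ x₂ :* (b :* d)) refl x₁ x₂ a b d ⟩
          x₁ * (a * d) + x₂ * (b * d)    ≡⟨ cong (λ z → x₁ * z + x₂ * (b * d)) (sym det) ⟩
          x₁ * (b * c) + x₂ * (b * d)
            ≡⟨ solve 5 (λ x₁ x₂ b c d → x₁ :* (b :* c) :+ x₂ :* (b :* d) := b :* (x₁ :* c :+ x₂ :* d)) refl x₁ x₂ b c d ⟩
          b * (x₁ * c + x₂ * d)          ≡⟨ cong (b *_) at-cd ⟩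
          b * t                          ≡⟨ *-comm b t ⟩
          t * b                          ∎

module BilinearForm {q : ℕ} (F : FiniteField q)
    (B : FiniteField.Vec2 F → FiniteField.Vec2 F → FiniteField.Carrier F)
    (bilinear : FiniteField.IsBilinear F B) (nondegenerate : FiniteField.IsNonDegenerate F B) where
  open FiniteField F
  open IsBilinear bilinear
  open IsNonDegenerate nondegenerate
  open FieldAlgebra F
  open Sums
  open Enumeration F
  open Int using () renaming (_*_ to _*ℤ_)
  open CommutativeRing commutativeRing using (+-identityˡ; +-identityʳ; *-identityʳ; zeroˡ; zeroʳ; -‿inverseʳ)
  open import Algebra.Properties.Ring (CommutativeRing.ring commutativeRing) using (-1*x≈-x)

  e₁ e₂ : Vec2
  e₁ = (1# , 0#)
  e₂ = (0# , 1#)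

  α β : Vec2 → Carrier
  α y = B e₁ y
  β y = B e₂ y

  B-coordinates : ∀ x y → B x y ≡ proj₁ x * α y + proj₂ x * β y
  B-coordinates (a , b) y = begin
      B (a , b) y                   ≡⟨ cong (λ v → B v y) decomposition ⟩
      B ((a · e₁) ⊕ (b · e₂)) y     ≡⟨ additiveˡ (a · e₁) (b · e₂) y ⟩
      B (a · e₁) y + B (b · e₂) y   ≡⟨ cong₂ _+_ (homogeneousˡ a e₁ y) (homogeneousˡ b e₂ y) ⟩
      a * α y + b * β y             ∎
    where
      open ≡-Reasoning
      decomposition : (a , b) ≡ (a · e₁) ⊕ (b · e₂)
      decomposition = cong₂ _,_
        (sym (trans (cong₂ _+_ (*-identityʳ a) (zeroʳ b)) (+-identityʳ a)))
        (sym (trans (cong₂ _+_ (zeroʳ a) (*-identityʳ b)) (+-identityˡ b)))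

  B-zeroˡ : ∀ y → B 𝟎 y ≡ 0#
  B-zeroˡ y = trans (B-coordinates 𝟎 y) (trans (cong₂ _+_ (zeroˡ (α y)) (zeroˡ (β y))) (+-identityʳ 0#))

  right-injective : ∀ {y y'} → (∀ x → B x y ≡ B x y') → y ≡ y'
  right-injective {y₁ , y₂} {y₁' , y₂'} same =
    cong₂ _,_ (difference-zero (first-coordinate (cong proj₁ y-y'≡0)))
              (difference-zero (first-coordinate (cong proj₂ y-y'≡0)))
    where
      open ≡-Reasoning
      first-coordinate : ∀ {a b} → a + - 1# * b ≡ 0# → a + - b ≡ 0#
      first-coordinate {a} {b} e = trans (cong (λ z → a + z) (sym (-1*x≈-x b))) e
      y-y'≡0 : (y₁ , y₂) ⊕ ((- 1#) · (y₁' , y₂')) ≡ 𝟎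
      y-y'≡0 = right _ (λ x → begin
          B x ((y₁ , y₂) ⊕ ((- 1#) · (y₁' , y₂')))                ≡⟨ additiveʳ x _ _ ⟩
          B x (y₁ , y₂) + B x ((- 1#) · (y₁' , y₂'))              ≡⟨ cong (λ z → B x (y₁ , y₂) + z) (homogeneousʳ (- 1#) x (y₁' , y₂')) ⟩
          B x (y₁ , y₂) + - 1# * B x (y₁' , y₂')                ≡⟨ cong₂ _+_ (same x) (-1*x≈-x _) ⟩
          B x (y₁' , y₂') + - B x (y₁' , y₂')                   ≡⟨ -‿inverseʳ _ ⟩
          0#                                                     ∎)

  coefficients-determine : ∀ {y y'} → α y ≡ α y' → β y ≡ β y' → y ≡ y'
  coefficients-determine {y} {y'} eα eβ = right-injective λ x →
    trans (B-coordinates x y) (trans (cong₂ (λ u v → proj₁ x * u + proj₂ x * v) eα eβ) (sym (B-coordinates x y')))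

  coefficients-nonzero : ∀ y → ¬ y ≡ 𝟎 → ¬ (α y ≡ 0# × β y ≡ 0#)
  coefficients-nonzero y y≢0 (α≡0 , β≡0) = y≢0 (right y (λ x → begin
      B x y                         ≡⟨ B-coordinates x y ⟩
      proj₁ x * α y + proj₂ x * β y ≡⟨ cong₂ (λ u v → proj₁ x * u + proj₂ x * v) α≡0 β≡0 ⟩
      proj₁ x * 0# + proj₂ x * 0#   ≡⟨ cong₂ _+_ (zeroʳ (proj₁ x)) (zeroʳ (proj₂ x)) ⟩
      0# + 0#                       ≡⟨ +-identityʳ 0# ⟩
      0#                            ∎))
    where open ≡-Reasoning

  ⟦==⟧-⇔ : ∀ {s t u v} → (s ≡ t) ⇔ (u ≡ v) → ⟦ s == t ⟧ ≡ ⟦ u == v ⟧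
  ⟦==⟧-⇔ {s} {t} {u} {v} s≡t⇔u≡v = cong ⟦_⟧ (does-⇔ s≡t⇔u≡v (s ≟ t) (u ≟ v))

  -- A linear equation a u + b v = t with (u, v) ≠ 0 has exactly q solutions
  -- (a, b): if v ≠ 0 there is one b for every a, otherwise one a for every b.
  linear-equation-count : ∀ u v t → ¬ (u ≡ 0# × v ≡ 0#) →
    ∑[ a ∈ elements ] ∑[ b ∈ elements ] ⟦ (a * u + b * v) == t ⟧ ≡ + q
  linear-equation-count u v t uv≢0 with v ≟ 0#
  ... | no v≢0 with inverse v v≢0
  ... | v⁻¹ , vv⁻¹≡1 = begin
      ∑[ a ∈ elements ] ∑[ b ∈ elements ] ⟦ (a * u + b * v) == t ⟧
    ≡⟨ ∑-cong elements (λ a → ∑-cong elements (λ b → ⟦==⟧-⇔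
         (⇔.trans (shift-equation (a * u) (b * v) t) (scale-equation vv⁻¹≡1 b (t + - (a * u)))))) ⟩
      ∑[ a ∈ elements ] ∑[ b ∈ elements ] ⟦ b == (v⁻¹ * (t + - (a * u))) ⟧
    ≡⟨ ∑-cong elements (λ a → elements-once (v⁻¹ * (t + - (a * u)))) ⟩
      ∑ elements (λ _ → 1ℤ)
    ≡⟨ ∑-elements-const 1ℤ ⟩
      + q *ℤ 1ℤ
    ≡⟨ ℤP.*-identityʳ (+ q) ⟩
      + q ∎
    where open ≡-Reasoning
  linear-equation-count u v t uv≢0 | yes v≡0 with u ≟ 0#
  ... | yes u≡0 = ⊥-elim (uv≢0 (u≡0 , v≡0))
  ... | no u≢0 with inverse u u≢0
  ... | u⁻¹ , uu⁻¹≡1 = begin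
      ∑[ a ∈ elements ] ∑[ b ∈ elements ] ⟦ (a * u + b * v) == t ⟧
    ≡⟨ ∑-cong elements (λ a → ∑-cong elements (λ b → ⟦==⟧-⇔
         (⇔.trans (mk⇔ (trans (sym (drop-b a b))) (trans (drop-b a b))) (scale-equation uu⁻¹≡1 a t)))) ⟩
      ∑[ a ∈ elements ] ∑[ b ∈ elements ] ⟦ a == (u⁻¹ * t) ⟧
    ≡⟨ ∑-cong elements (λ a → ∑-elements-const ⟦ a == (u⁻¹ * t) ⟧) ⟩
      ∑[ a ∈ elements ] (+ q *ℤ ⟦ a == (u⁻¹ * t) ⟧)
    ≡⟨ ∑-*ˡ elements (+ q) (λ a → ⟦ a == (u⁻¹ * t) ⟧) ⟩
      + q *ℤ ∑[ a ∈ elements ] ⟦ a == (u⁻¹ * t) ⟧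
    ≡⟨ cong (+ q *ℤ_) (elements-once (u⁻¹ * t)) ⟩
      + q *ℤ 1ℤ
    ≡⟨ ℤP.*-identityʳ (+ q) ⟩
      + q ∎
    where
      open ≡-Reasoning
      drop-b : ∀ a b → a * u + b * v ≡ a * u
      drop-b a b = trans (cong (λ z → a * u + b * z) v≡0) (trans (cong (λ z → a * u + z) (zeroʳ b)) (+-identityʳ _))

  line-count : ∀ y → ¬ y ≡ 𝟎 → ∀ t → ∑[ x ∈ points ] ⟦ B x y == t ⟧ ≡ + q
  line-count y y≢0 t = begin
      ∑[ x ∈ points ] ⟦ B x y == t ⟧
    ≡⟨ ∑-cartesian elements elements (λ x → ⟦ B x y == t ⟧) ⟩
      ∑[ a ∈ elements ] ∑[ b ∈ elements ] ⟦ B (a , b) y == t ⟧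
    ≡⟨ ∑-cong elements (λ a → ∑-cong elements (λ b → cong (λ s → ⟦ s == t ⟧) (B-coordinates (a , b) y))) ⟩
      ∑[ a ∈ elements ] ∑[ b ∈ elements ] ⟦ (a * α y + b * β y) == t ⟧
    ≡⟨ linear-equation-count (α y) (β y) t (coefficients-nonzero y y≢0) ⟩
      + q ∎
    where open ≡-Reasoning

  -- For y ≠ y' and t ≠ 0 the lines B(·, y) = t and B(·, y') = t meet in at
  -- most one point: otherwise the difference of two common points would be
  -- a nonzero vector annihilated by both forms, forcing the forms (and so y,
  -- y') to coincide.
  lines-meet-once : ∀ {y y' t} → ¬ y ≡ y' → ¬ t ≡ 0# → ∀ {x x'} →
                    B x y ≡ t → B x y' ≡ t → B x' y ≡ t → B x' y' ≡ t → x ≡ x'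
  lines-meet-once {y} {y'} {t} y≢y' t≢0 {x₁ , x₂} {x₁' , x₂'} xy xy' x'y x'y'
    with ((x₁ + - x₁') ≟ 0#) ×-dec ((x₂ + - x₂') ≟ 0#)
  ... | yes (d₁ , d₂) = cong₂ _,_ (difference-zero d₁) (difference-zero d₂)
  ... | no u≢0 = ⊥-elim (y≢y' (coefficients-determine (proj₁ forms-equal) (proj₂ forms-equal)))
    where
      annihilates : ∀ z → B (x₁ , x₂) z ≡ t → B (x₁' , x₂') z ≡ t →
                    (x₁ + - x₁') * α z + (x₂ + - x₂') * β z ≡ 0#
      annihilates z xz x'z = trans (difference-linear x₁ x₂ x₁' x₂' (α z) (β z))
        (trans (cong₂ (λ u v → u + - v) (trans (sym (B-coordinates _ z)) xz) (trans (sym (B-coordinates _ z)) x'z))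
               (-‿inverseʳ t))
      forms-equal : α y ≡ α y' × β y ≡ β y'
      forms-equal = equal-forms (α y) (β y) (α y') (β y')
        (determinant-zero (α y) (β y) (α y') (β y') (annihilates y xy x'y) (annihilates y' xy' x'y') u≢0)
        t≢0 (trans (sym (B-coordinates _ y)) xy) (trans (sym (B-coordinates _ y')) xy')

module FinalArithmetic where
  open Int using (_+_; _*_; _-_; -_; _≤_; _<_; _^_)
  open IntegerFacts

  cancel-square : ∀ {e D' D M} → 0ℤ < e → 0ℤ < D' → e * D' ≤ D → D * D ≤ (e * e) * M → D' * D' ≤ M
  cancel-square {+[1+ n ]} {D'} {D} {M} _ 0<D' eD'≤D D²≤e²M =
    ℤP.*-cancelˡ-≤-pos (D' * D') M (+[1+ n ] * +[1+ n ])
      (ℤP.≤-trans (ℤP.≤-reflexive (rearrange +[1+ n ] D'))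
                  (ℤP.≤-trans (square-mono (*-nonneg {+[1+ n ]} {D'} (+≤+ ℕ.z≤n) (ℤP.<⇒≤ 0<D')) eD'≤D) D²≤e²M))
    where rearrange : ∀ e d → (e * e) * (d * d) ≡ (e * d) * (e * d)
          rearrange = solve-∀
  cancel-square {+ zero} (Int.+<+ ()) _ _ _

  -- For e = 0 the quantity (Q - N) e - Q² + Q = Q - Q² is not positive.
  positive-if-gap : ∀ {Q N e} → 1ℤ ≤ Q → 0ℤ ≤ e → 0ℤ < (Q - N) * e - Q * Q + Q → 0ℤ < e
  positive-if-gap {Q} {N} {+ zero} 1≤Q _ 0<gap =
    ⊥-elim (ℤP.<⇒≱ 0<gap (subst (_≤ 0ℤ) (sym (at-zero Q N))
                              (ℤP.neg-mono-≤ (*-nonneg (ℤP.≤-trans (+≤+ ℕ.z≤n) 1≤Q) (ℤP.i≤j⇒0≤j-i 1≤Q)))))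
    where at-zero : ∀ Q N → (Q - N) * 0ℤ - Q * Q + Q ≡ - (Q * (Q - 1ℤ))
          at-zero = solve-∀
  positive-if-gap {e = +[1+ n ]} _ _ _ = Int.+<+ (ℕ.s≤s ℕ.z≤n)

  -- For R > 0 one has 0 < R ≤ D' = (Q - N) e* - Q² + Q and e* D' ≤ D.
  final-inequality : ∀ (Q N e e* ν₀ D : ℤ) → 1ℤ ≤ Q → 0ℤ ≤ N → 0ℤ ≤ e* → e* ≤ e → e ≤ e* + 1ℤ →
    ν₀ ≤ e* * (Q - 1ℤ) → D ≡ Q * (e* * e* - ν₀) - e* * e* * N → D * D ≤ (e* * e*) * (N * N * (Q * Q * Q)) →
    let R = (Q - N) * e - Q * Q in R ≤ + 0 ⊎ R * R ≤ N * N * Q ^ 3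
  final-inequality Q N e e* ν₀ D 1≤Q 0≤N 0≤e* e*≤e e≤e*+1 ν₀≤ D≡ D²≤ with (Q - N) * e - Q * Q ℤP.≤? + 0
  ... | yes R≤0 = inj₁ R≤0
  ... | no R≰0 = inj₂ (subst (R * R ≤_) (cube (N * N) Q) (ℤP.≤-trans (square-mono (ℤP.<⇒≤ 0<R) R≤D') D'²≤))
    where
      R = (Q - N) * e - Q * Q
      D' = (Q - N) * e* - Q * Q + Q
      0≤Q : 0ℤ ≤ Q
      0≤Q = ℤP.≤-trans (+≤+ ℕ.z≤n) 1≤Q
      0<R : 0ℤ < R
      0<R = ℤP.≰⇒> R≰0
      R≤D' : R ≤ D'
      R≤D' = ℤP.0≤i-j⇒j≤i (subst (0ℤ ≤_) (gap Q N e e*)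
        (ℤP.+-mono-≤ (*-nonneg 0≤Q (ℤP.i≤j⇒0≤j-i e≤e*+1)) (*-nonneg 0≤N (ℤP.i≤j⇒0≤j-i e*≤e))))
        where gap : ∀ Q N e e* → Q * ((e* + 1ℤ) - e) + N * (e - e*) ≡ ((Q - N) * e* - Q * Q + Q) - ((Q - N) * e - Q * Q)
              gap = solve-∀
      e*D'≤D : e* * D' ≤ D
      e*D'≤D = ℤP.0≤i-j⇒j≤i (subst (0ℤ ≤_) (trans (gap Q N e* ν₀) (cong (_- e* * D') (sym D≡)))
        (*-nonneg 0≤Q (ℤP.i≤j⇒0≤j-i ν₀≤)))
        where gap : ∀ Q N e* ν₀ → Q * (e* * (Q - 1ℤ) - ν₀)
                                  ≡ (Q * (e* * e* - ν₀) - e* * e* * N) - e* * ((Q - N) * e* - Q * Q + Q)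
              gap = solve-∀
      0<D' : 0ℤ < D'
      0<D' = ℤP.<-≤-trans 0<R R≤D'
      D'²≤ : D' * D' ≤ N * N * (Q * Q * Q)
      D'²≤ = cancel-square (positive-if-gap 1≤Q 0≤e* 0<D') 0<D' e*D'≤D D²≤
      cube : ∀ M Q → M * (Q * Q * Q) ≡ M * (Q * (Q * (Q * 1ℤ)))
      cube = solve-∀

module Incidences {q : ℕ} (F : FiniteField q)
    (B : FiniteField.Vec2 F → FiniteField.Vec2 F → FiniteField.Carrier F)
    (bilinear : FiniteField.IsBilinear F B) (nondegenerate : FiniteField.IsNonDegenerate F B)
    (E : FiniteField.Vec2 F → Bool) where
  open Int using (_+_; _*_; _-_; _≤_)
  open IntegerFacts
  open Sums
  open FiniteField F using (Carrier; Vec2; 𝟎; 0#; _≟_; _==_; enum; elements; points; card; cardBstar)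
  open Enumeration F
  open BilinearForm F B bilinear nondegenerate using (B-zeroˡ; line-count; lines-meet-once)

  true≢false : ¬ (true ≡ false)
  true≢false ()

  Q : ℤ
  Q = + q

  -- q ≥ 1, since F contains 0.
  1≤Q : 1ℤ ≤ Q
  1≤Q = +≤+ (inhabited q (Inverse.to enum 0#))
    where inhabited : ∀ n → Fin n → 1 ℕ.≤ n
          inhabited (suc n) _ = ℕ.s≤s ℕ.z≤n

  E* : Vec2 → Bool
  E* x = E x ∧ not (x ==v 𝟎)

  e* : ℤ
  e* = ∑[ x ∈ points ] ⟦ E* x ⟧

  e*-nonneg : 0ℤ ≤ e*
  e*-nonneg = ∑-nonneg points (λ x → ⟦⟧-nonneg (E* x))

  E*-nonzero : ∀ {x} → E* x ≡ true → ¬ x ≡ 𝟎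
  E*-nonzero {x} E*x x≡𝟎 = true≢false
    (trans (sym E*x) (trans (cong (λ b → E x ∧ not b) (dec-true (x ≟v 𝟎) x≡𝟎)) (BoolP.∧-zeroʳ (E x))))

  a : Carrier → Vec2 → ℤ
  a t x = ∑[ y ∈ points ] (⟦ E* y ⟧ * ⟦ B x y == t ⟧)

  ν : Carrier → ℤ
  ν t = ∑[ x ∈ points ] (⟦ E* x ⟧ * a t x)

  -- Membership in B*(E), written exactly as cardBstar counts it.
  witnessed : Carrier → Bool
  witnessed c = any (λ x → any (λ y → E x ∧ E y ∧ (B x y == c)) points) points

  inB* : Carrier → Bool
  inB* c = not (c == 0#) ∧ witnessed c

  N : ℤ
  N = + cardBstar B E

  N≡∑ : N ≡ ∑[ t ∈ elements ] ⟦ inB* t ⟧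
  N≡∑ = length-filter elements inB*

  inB*-nonzero : ∀ {t} → inB* t ≡ true → ¬ t ≡ 0#
  inB*-nonzero {t} t∈B* t≡0 = true≢false (trans (sym t∈B*) (cong (λ b → not b ∧ witnessed t) (dec-true (t ≟ 0#) t≡0)))

  -- Each pair of E* × E* is counted at exactly one value: Σ_t ν(t) = e*².
  ν-total : ∑[ t ∈ elements ] ν t ≡ e* * e*
  ν-total = begin
      ∑[ t ∈ elements ] ∑[ x ∈ points ] (⟦ E* x ⟧ * a t x)
    ≡⟨ ∑-swap elements points (λ t x → ⟦ E* x ⟧ * a t x) ⟩
      ∑[ x ∈ points ] ∑[ t ∈ elements ] (⟦ E* x ⟧ * a t x)
    ≡⟨ ∑-cong points (λ x → trans (∑-*ˡ elements ⟦ E* x ⟧ (λ t → a t x)) (cong (⟦ E* x ⟧ *_) (a-over-values x))) ⟩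
      ∑[ x ∈ points ] (⟦ E* x ⟧ * e*)
    ≡⟨ ∑-*ʳ points e* (λ x → ⟦ E* x ⟧) ⟩
      e* * e* ∎
    where
      open ≡-Reasoning
      a-over-values : ∀ x → ∑[ t ∈ elements ] a t x ≡ e*
      a-over-values x = begin
          ∑[ t ∈ elements ] ∑[ y ∈ points ] (⟦ E* y ⟧ * ⟦ B x y == t ⟧)
        ≡⟨ ∑-swap elements points (λ t y → ⟦ E* y ⟧ * ⟦ B x y == t ⟧) ⟩
          ∑[ y ∈ points ] ∑[ t ∈ elements ] (⟦ E* y ⟧ * ⟦ B x y == t ⟧)
        ≡⟨ ∑-cong points (λ y → trans (∑-*ˡ elements ⟦ E* y ⟧ (λ t → ⟦ B x y == t ⟧))
             (trans (cong (⟦ E* y ⟧ *_) (elements-once′ (B x y))) (ℤP.*-identityʳ _))) ⟩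
          e* ∎

  ν-vanishes : ∀ t → witnessed t ≡ false → ν t ≡ 0ℤ
  ν-vanishes t none = trans (∑-cong points (λ x → sym (∑-*ˡ points ⟦ E* x ⟧ _)))
    (∑-vanishes points _ _ none (λ x none-x → ∑-vanishes points _ _ none-x (pair-term-zero x)))
    where
      pair-term-zero : ∀ x y → (E x ∧ E y ∧ (B x y == t)) ≡ false →
                       ⟦ E* x ⟧ * (⟦ E* y ⟧ * ⟦ B x y == t ⟧) ≡ 0ℤ
      pair-term-zero x y not-pair with E x | E y | B x y == t
      ... | false | _ | _ = refl
      ... | true | false | _ = ℤP.*-zeroʳ ⟦ not (x ==v 𝟎) ⟧
      ... | true | true | false = trans (cong (⟦ not (x ==v 𝟎) ⟧ *_) (ℤP.*-zeroʳ ⟦ not (y ==v 𝟎) ⟧)) (ℤP.*-zeroʳ ⟦ not (x ==v 𝟎) ⟧)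
      pair-term-zero x y () | true | true | true

  ν-split : ∀ t → ν t ≡ ⟦ t == 0# ⟧ * ν t + ⟦ inB* t ⟧ * ν t
  ν-split t with t == 0#
  ... | true = sym (trans (cong (_+ 0ℤ) (ℤP.*-identityˡ (ν t))) (ℤP.+-identityʳ (ν t)))
  ... | false with witnessed t in w
  ...   | true = sym (trans (ℤP.+-identityˡ _) (ℤP.*-identityˡ (ν t)))
  ...   | false = ν-vanishes t w

  ν-on-B* : ∑[ t ∈ elements ] (⟦ inB* t ⟧ * ν t) ≡ e* * e* - ν 0#
  ν-on-B* = begin
      ∑[ t ∈ elements ] (⟦ inB* t ⟧ * ν t)
    ≡⟨ add-subtract (ν 0#) _ ⟩
      ν 0# + ∑[ t ∈ elements ] (⟦ inB* t ⟧ * ν t) - ν 0#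
    ≡⟨ cong (λ z → z + ∑[ t ∈ elements ] (⟦ inB* t ⟧ * ν t) - ν 0#) (sym (sift _≟_ elements 0# ν (elements-once 0#))) ⟩
      ∑[ t ∈ elements ] (⟦ t == 0# ⟧ * ν t) + ∑[ t ∈ elements ] (⟦ inB* t ⟧ * ν t) - ν 0#
    ≡⟨ cong (λ z → z - ν 0#) (sym (∑-+ elements _ _)) ⟩
      ∑[ t ∈ elements ] (⟦ t == 0# ⟧ * ν t + ⟦ inB* t ⟧ * ν t) - ν 0#
    ≡⟨ cong (λ z → z - ν 0#) (∑-cong elements (λ t → sym (ν-split t))) ⟩
      ∑[ t ∈ elements ] ν t - ν 0#
    ≡⟨ cong (λ z → z - ν 0#) ν-total ⟩
      e* * e* - ν 0# ∎
    where
      open ≡-Reasoning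
      add-subtract : ∀ u v → v ≡ u + v - u
      add-subtract = solve-∀

  -- A line B(·, y) = 0 with y ≠ 0 passes through the origin, so it has
  -- q - 1 points besides the origin.
  punctured-line-count : ∀ y → ¬ y ≡ 𝟎 → ∑[ x ∈ points ] (⟦ not (x ==v 𝟎) ⟧ * ⟦ B x y == 0# ⟧) ≡ Q - 1ℤ
  punctured-line-count y y≢0 = begin
      ∑[ x ∈ points ] (⟦ not (x ==v 𝟎) ⟧ * ⟦ B x y == 0# ⟧)
    ≡⟨ ∑-cong points (λ x → trans (cong (_* ⟦ B x y == 0# ⟧) (⟦not⟧ (x ==v 𝟎))) (complement ⟦ x ==v 𝟎 ⟧ ⟦ B x y == 0# ⟧)) ⟩
      ∑[ x ∈ points ] (⟦ B x y == 0# ⟧ - ⟦ x ==v 𝟎 ⟧ * ⟦ B x y == 0# ⟧)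
    ≡⟨ ∑-- points _ _ ⟩
      ∑[ x ∈ points ] ⟦ B x y == 0# ⟧ - ∑[ x ∈ points ] (⟦ x ==v 𝟎 ⟧ * ⟦ B x y == 0# ⟧)
    ≡⟨ cong₂ _-_ (line-count y y≢0 0#) (sift _≟v_ points 𝟎 (λ x → ⟦ B x y == 0# ⟧) (points-once 𝟎)) ⟩
      Q - ⟦ B 𝟎 y == 0# ⟧
    ≡⟨ cong (λ b → Q - ⟦ b ⟧) (dec-true (B 𝟎 y ≟ 0#) (B-zeroˡ y)) ⟩
      Q - 1ℤ ∎
    where
      open ≡-Reasoning
      complement : ∀ i b → (1ℤ - i) * b ≡ b - i * b
      complement = solve-∀

  ν-by-columns : ∀ t → ν t ≡ ∑[ y ∈ points ] (⟦ E* y ⟧ * ∑[ x ∈ points ] (⟦ E* x ⟧ * ⟦ B x y == t ⟧))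
  ν-by-columns t = begin
      ∑[ x ∈ points ] (⟦ E* x ⟧ * ∑[ y ∈ points ] (⟦ E* y ⟧ * ⟦ B x y == t ⟧))
    ≡⟨ ∑-cong points (λ x → sym (∑-*ˡ points ⟦ E* x ⟧ _)) ⟩
      ∑[ x ∈ points ] ∑[ y ∈ points ] (⟦ E* x ⟧ * (⟦ E* y ⟧ * ⟦ B x y == t ⟧))
    ≡⟨ ∑-swap points points _ ⟩
      ∑[ y ∈ points ] ∑[ x ∈ points ] (⟦ E* x ⟧ * (⟦ E* y ⟧ * ⟦ B x y == t ⟧))
    ≡⟨ ∑-cong points (λ y → trans (∑-cong points (λ x → exchange ⟦ E* x ⟧ ⟦ E* y ⟧ ⟦ B x y == t ⟧))
                                   (∑-*ˡ points ⟦ E* y ⟧ _)) ⟩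
      ∑[ y ∈ points ] (⟦ E* y ⟧ * ∑[ x ∈ points ] (⟦ E* x ⟧ * ⟦ B x y == t ⟧)) ∎
    where
      open ≡-Reasoning
      exchange : ∀ a b c → a * (b * c) ≡ b * (a * c)
      exchange = solve-∀

  ν-zero-bound : ν 0# ≤ e* * (Q - 1ℤ)
  ν-zero-bound = begin
      ν 0#
    ≡⟨ ν-by-columns 0# ⟩
      ∑[ y ∈ points ] (⟦ E* y ⟧ * ∑[ x ∈ points ] (⟦ E* x ⟧ * ⟦ B x y == 0# ⟧))
    ≤⟨ ∑-mono points (λ y → ⟦⟧-guard-≤ (E* y) (λ E*y → column-bound y (E*-nonzero E*y))) ⟩
      ∑[ y ∈ points ] (⟦ E* y ⟧ * (Q - 1ℤ))
    ≡⟨ ∑-*ʳ points (Q - 1ℤ) (λ y → ⟦ E* y ⟧) ⟩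
      e* * (Q - 1ℤ) ∎
    where
      open ℤP.≤-Reasoning
      column-bound : ∀ y → ¬ y ≡ 𝟎 → ∑[ x ∈ points ] (⟦ E* x ⟧ * ⟦ B x y == 0# ⟧) ≤ Q - 1ℤ
      column-bound y y≢0 = ℤP.≤-trans
        (∑-mono points (λ x → *-monoʳ-nonneg (⟦⟧-nonneg (B x y == 0#)) (⟦∧⟧-≤ʳ (E x) (not (x ==v 𝟎)))))
        (ℤP.≤-reflexive (punctured-line-count y y≢0))

  -- Every y ∈ E* contributes a line: Σ_x a_t(x) = q e*.
  a-sum : ∀ t → ∑[ x ∈ points ] a t x ≡ e* * Q
  a-sum t = begin
      ∑[ x ∈ points ] ∑[ y ∈ points ] (⟦ E* y ⟧ * ⟦ B x y == t ⟧)
    ≡⟨ ∑-swap points points (λ x y → ⟦ E* y ⟧ * ⟦ B x y == t ⟧) ⟩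
      ∑[ y ∈ points ] ∑[ x ∈ points ] (⟦ E* y ⟧ * ⟦ B x y == t ⟧)
    ≡⟨ ∑-cong points (λ y → trans (∑-*ˡ points ⟦ E* y ⟧ (λ x → ⟦ B x y == t ⟧))
                                   (⟦⟧-guard-≡ (E* y) (λ E*y → line-count y (E*-nonzero E*y) t))) ⟩
      ∑[ y ∈ points ] (⟦ E* y ⟧ * Q)
    ≡⟨ ∑-*ʳ points Q (λ y → ⟦ E* y ⟧) ⟩
      e* * Q ∎
    where open ≡-Reasoning

  common : Carrier → Vec2 → Vec2 → ℤ
  common t y y' = ∑[ x ∈ points ] (⟦ B x y == t ⟧ * ⟦ B x y' == t ⟧)

  common-bound : ∀ {t} → ¬ t ≡ 0# → ∀ {y} y' → ¬ y ≡ 𝟎 → common t y y' ≤ 1ℤ + (Q - 1ℤ) * ⟦ y' ==v y ⟧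
  common-bound {t} t≢0 {y} y' y≢0 with y' ≟v y
  ... | yes refl = ℤP.≤-reflexive (begin
      common t y y                 ≡⟨ ∑-cong points (λ x → ⟦⟧-idempotent (B x y == t)) ⟩
      ∑[ x ∈ points ] ⟦ B x y == t ⟧ ≡⟨ line-count y y≢0 t ⟩
      Q                            ≡⟨ diagonal Q ⟩
      1ℤ + (Q - 1ℤ) * 1ℤ           ≡⟨ cong (λ b → 1ℤ + (Q - 1ℤ) * ⟦ b ⟧) (sym (dec-true (y ≟v y) refl)) ⟩
      1ℤ + (Q - 1ℤ) * ⟦ y ==v y ⟧  ∎)
    where
      open ≡-Reasoning
      diagonal : ∀ Q → Q ≡ 1ℤ + (Q - 1ℤ) * 1ℤ
      diagonal = solve-∀
  ... | no y'≢y = ℤP.≤-trans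
      (ℤP.≤-trans (ℤP.≤-reflexive (∑-cong points (λ x → sym (⟦∧⟧ (B x y == t) (B x y' == t)))))
                  (at-most-one _ meet-once))
      (ℤP.≤-reflexive (trans (off-diagonal (Q - 1ℤ)) (cong (λ b → 1ℤ + (Q - 1ℤ) * ⟦ b ⟧) (sym (dec-false (y' ≟v y) y'≢y)))))
    where
      meet-once : ∀ x x' → ((B x y == t) ∧ (B x y' == t)) ≡ true → ((B x' y == t) ∧ (B x' y' == t)) ≡ true → x ≡ x'
      meet-once x x' on-x on-x' = lines-meet-once (λ y≡y' → y'≢y (sym y≡y')) t≢0
        (decided (B x y ≟ t) (BoolP.∧-conicalˡ _ _ on-x)) (decided (B x y' ≟ t) (BoolP.∧-conicalʳ _ _ on-x))
        (decided (B x' y ≟ t) (BoolP.∧-conicalˡ _ _ on-x')) (decided (B x' y' ≟ t) (BoolP.∧-conicalʳ _ _ on-x'))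
      off-diagonal : ∀ k → 1ℤ ≡ 1ℤ + k * 0ℤ
      off-diagonal = solve-∀

  -- Σ_x a_t(x)² counts triples (x, y, y') with y, y' ∈ E* on common lines.
  a-square-expand : ∀ t → ∑[ x ∈ points ] (a t x * a t x)
                          ≡ ∑[ y ∈ points ] ∑[ y' ∈ points ] ((⟦ E* y ⟧ * ⟦ E* y' ⟧) * common t y y')
  a-square-expand t = begin
      ∑[ x ∈ points ] (a t x * a t x)
    ≡⟨ ∑-cong points (λ x → ∑-product points (λ y → ⟦ E* y ⟧ * ⟦ B x y == t ⟧) (λ y → ⟦ E* y ⟧ * ⟦ B x y == t ⟧)) ⟩
      ∑[ x ∈ points ] ∑[ y ∈ points ] ∑[ y' ∈ points ] term x y y'
    ≡⟨ ∑-swap points points _ ⟩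
      ∑[ y ∈ points ] ∑[ x ∈ points ] ∑[ y' ∈ points ] term x y y'
    ≡⟨ ∑-cong points (λ y → ∑-swap points points _) ⟩
      ∑[ y ∈ points ] ∑[ y' ∈ points ] ∑[ x ∈ points ] term x y y'
    ≡⟨ ∑-cong points (λ y → ∑-cong points (λ y' →
         trans (∑-cong points (λ x → regroup ⟦ E* y ⟧ ⟦ B x y == t ⟧ ⟦ E* y' ⟧ ⟦ B x y' == t ⟧))
               (∑-*ˡ points (⟦ E* y ⟧ * ⟦ E* y' ⟧) _))) ⟩
      ∑[ y ∈ points ] ∑[ y' ∈ points ] ((⟦ E* y ⟧ * ⟦ E* y' ⟧) * common t y y') ∎
    where
      open ≡-Reasoning
      term : Vec2 → Vec2 → Vec2 → ℤ
      term x y y' = (⟦ E* y ⟧ * ⟦ B x y == t ⟧) * (⟦ E* y' ⟧ * ⟦ B x y' == t ⟧)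
      regroup : ∀ a b c d → (a * b) * (c * d) ≡ (a * c) * (b * d)
      regroup = solve-∀

  -- For fixed y the bound of common-bound sums to e* [y ∈ E*] + (q - 1) [y ∈ E*]:
  -- the diagonal term is sifted out.
  pair-bound-row : ∀ y → ∑[ y' ∈ points ] ((⟦ E* y ⟧ * ⟦ E* y' ⟧) * (1ℤ + (Q - 1ℤ) * ⟦ y' ==v y ⟧))
                         ≡ ⟦ E* y ⟧ * e* + (Q - 1ℤ) * ⟦ E* y ⟧
  pair-bound-row y = begin
      ∑[ y' ∈ points ] ((⟦ E* y ⟧ * ⟦ E* y' ⟧) * (1ℤ + (Q - 1ℤ) * ⟦ y' ==v y ⟧))
    ≡⟨ ∑-cong points (λ y' → distribute ⟦ E* y ⟧ ⟦ E* y' ⟧ (Q - 1ℤ) ⟦ y' ==v y ⟧) ⟩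
      ∑[ y' ∈ points ] (⟦ E* y ⟧ * ⟦ E* y' ⟧ + ((Q - 1ℤ) * ⟦ E* y ⟧) * (⟦ y' ==v y ⟧ * ⟦ E* y' ⟧))
    ≡⟨ ∑-+ points _ _ ⟩
      ∑[ y' ∈ points ] (⟦ E* y ⟧ * ⟦ E* y' ⟧) + ∑[ y' ∈ points ] (((Q - 1ℤ) * ⟦ E* y ⟧) * (⟦ y' ==v y ⟧ * ⟦ E* y' ⟧))
    ≡⟨ cong₂ _+_ (∑-*ˡ points ⟦ E* y ⟧ (λ y' → ⟦ E* y' ⟧))
                 (trans (∑-*ˡ points ((Q - 1ℤ) * ⟦ E* y ⟧) _)
                        (cong (((Q - 1ℤ) * ⟦ E* y ⟧) *_) (sift _≟v_ points y (λ y' → ⟦ E* y' ⟧) (points-once y)))) ⟩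
      ⟦ E* y ⟧ * e* + ((Q - 1ℤ) * ⟦ E* y ⟧) * ⟦ E* y ⟧
    ≡⟨ cong (λ z → ⟦ E* y ⟧ * e* + z)
            (trans (ℤP.*-assoc (Q - 1ℤ) ⟦ E* y ⟧ ⟦ E* y ⟧) (cong ((Q - 1ℤ) *_) (⟦⟧-idempotent (E* y)))) ⟩
      ⟦ E* y ⟧ * e* + (Q - 1ℤ) * ⟦ E* y ⟧ ∎
    where
      open ≡-Reasoning
      distribute : ∀ a b k c → (a * b) * (1ℤ + k * c) ≡ a * b + (k * a) * (c * b)
      distribute = solve-∀

  a-square-bound : ∀ {t} → ¬ t ≡ 0# → ∑[ x ∈ points ] (a t x * a t x) ≤ e* * e* + (Q - 1ℤ) * e*
  a-square-bound {t} t≢0 = begin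
      ∑[ x ∈ points ] (a t x * a t x)
    ≡⟨ a-square-expand t ⟩
      ∑[ y ∈ points ] ∑[ y' ∈ points ] ((⟦ E* y ⟧ * ⟦ E* y' ⟧) * common t y y')
    ≤⟨ ∑-mono points (λ y → ∑-mono points (pair-bound y)) ⟩
      ∑[ y ∈ points ] ∑[ y' ∈ points ] ((⟦ E* y ⟧ * ⟦ E* y' ⟧) * (1ℤ + (Q - 1ℤ) * ⟦ y' ==v y ⟧))
    ≡⟨ ∑-cong points pair-bound-row ⟩
      ∑[ y ∈ points ] (⟦ E* y ⟧ * e* + (Q - 1ℤ) * ⟦ E* y ⟧)
    ≡⟨ ∑-+ points _ _ ⟩
      ∑[ y ∈ points ] (⟦ E* y ⟧ * e*) + ∑[ y ∈ points ] ((Q - 1ℤ) * ⟦ E* y ⟧)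
    ≡⟨ cong₂ _+_ (∑-*ʳ points e* (λ y → ⟦ E* y ⟧)) (∑-*ˡ points (Q - 1ℤ) (λ y → ⟦ E* y ⟧)) ⟩
      e* * e* + (Q - 1ℤ) * e* ∎
    where
      open ℤP.≤-Reasoning
      pair-bound : ∀ y y' → (⟦ E* y ⟧ * ⟦ E* y' ⟧) * common t y y'
                            ≤ (⟦ E* y ⟧ * ⟦ E* y' ⟧) * (1ℤ + (Q - 1ℤ) * ⟦ y' ==v y ⟧)
      pair-bound y y' = subst₂ _≤_
        (cong (_* common t y y') (⟦∧⟧ (E* y) (E* y')))
        (cong (_* (1ℤ + (Q - 1ℤ) * ⟦ y' ==v y ⟧)) (⟦∧⟧ (E* y) (E* y')))
        (⟦⟧-guard-≤ (E* y ∧ E* y') (λ both → common-bound t≢0 y' (E*-nonzero (BoolP.∧-conicalˡ _ _ both))))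

  deviation-bound : ∀ {t} → ¬ t ≡ 0# → ∑[ x ∈ points ] ((Q * a t x - e*) * (Q * a t x - e*)) ≤ Q * Q * Q * e*
  deviation-bound {t} t≢0 = begin
      ∑[ x ∈ points ] ((Q * a t x - e*) * (Q * a t x - e*))
    ≡⟨ ∑-square-expand points Q e* (a t) ⟩
      (Q * Q) * ∑[ x ∈ points ] (a t x * a t x) - ((Q + Q) * e*) * ∑ points (a t) + ∑ points (λ _ → e* * e*)
    ≡⟨ cong₂ (λ s c → (Q * Q) * ∑[ x ∈ points ] (a t x * a t x) - ((Q + Q) * e*) * s + c)
             (a-sum t) (∑-points-const (e* * e*)) ⟩
      (Q * Q) * ∑[ x ∈ points ] (a t x * a t x) - ((Q + Q) * e*) * (e* * Q) + Q * (Q * (e* * e*))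
    ≤⟨ ℤP.+-monoˡ-≤ _ (ℤP.+-monoˡ-≤ _ (*-monoˡ-nonneg (square-nonneg Q) (a-square-bound t≢0))) ⟩
      (Q * Q) * (e* * e* + (Q - 1ℤ) * e*) - ((Q + Q) * e*) * (e* * Q) + Q * (Q * (e* * e*))
    ≡⟨ simplify Q e* ⟩
      Q * Q * Q * e* - Q * Q * e*
    ≤⟨ ℤP.i-j≤i (Q * Q * Q * e*) (Q * Q * e*) {{Int.nonNegative (*-nonneg (square-nonneg Q) e*-nonneg)}} ⟩
      Q * Q * Q * e* ∎
    where
      open ℤP.≤-Reasoning
      simplify : ∀ Q e → (Q * Q) * (e * e + (Q - 1ℤ) * e) - ((Q + Q) * e) * (e * Q) + Q * (Q * (e * e))
                         ≡ Q * Q * Q * e - Q * Q * e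
      simplify = solve-∀

  ν-deviation : ∀ t → Q * ν t - e* * e* ≡ ∑[ x ∈ points ] (⟦ E* x ⟧ * (Q * a t x - e*))
  ν-deviation t = begin
      Q * ν t - e* * e*
    ≡⟨ cong₂ _-_ (sym (∑-*ˡ points Q _)) (sym (∑-*ʳ points e* (λ x → ⟦ E* x ⟧))) ⟩
      ∑[ x ∈ points ] (Q * (⟦ E* x ⟧ * a t x)) - ∑[ x ∈ points ] (⟦ E* x ⟧ * e*)
    ≡⟨ sym (∑-- points _ _) ⟩
      ∑[ x ∈ points ] (Q * (⟦ E* x ⟧ * a t x) - ⟦ E* x ⟧ * e*)
    ≡⟨ ∑-cong points (λ x → factor Q ⟦ E* x ⟧ (a t x) e*) ⟩
      ∑[ x ∈ points ] (⟦ E* x ⟧ * (Q * a t x - e*)) ∎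
    where
      open ≡-Reasoning
      factor : ∀ Q i a e → Q * (i * a) - i * e ≡ i * (Q * a - e)
      factor = solve-∀

  ν-deviation-bound : ∀ {t} → ¬ t ≡ 0# → (Q * ν t - e* * e*) * (Q * ν t - e* * e*) ≤ e* * (Q * Q * Q * e*)
  ν-deviation-bound {t} t≢0 = begin
      (Q * ν t - e* * e*) * (Q * ν t - e* * e*)
    ≡⟨ cong₂ _*_ (ν-deviation t) (ν-deviation t) ⟩
      ∑[ x ∈ points ] (⟦ E* x ⟧ * g x) * ∑[ x ∈ points ] (⟦ E* x ⟧ * g x)
    ≤⟨ cauchy-schwarz-on points E* g ⟩
      e* * ∑[ x ∈ points ] (⟦ E* x ⟧ * (g x * g x))
    ≤⟨ *-monoˡ-nonneg e*-nonneg (∑-mono points (λ x → ⟦⟧-weaken (E* x) (square-nonneg (g x)))) ⟩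
      e* * ∑[ x ∈ points ] (g x * g x)
    ≤⟨ *-monoˡ-nonneg e*-nonneg (deviation-bound t≢0) ⟩
      e* * (Q * Q * Q * e*) ∎
    where
      open ℤP.≤-Reasoning
      g : Vec2 → ℤ
      g x = Q * a t x - e*

  D : ℤ
  D = ∑[ t ∈ elements ] (⟦ inB* t ⟧ * (Q * ν t - e* * e*))

  D-formula : D ≡ Q * (e* * e* - ν 0#) - e* * e* * N
  D-formula = begin
      ∑[ t ∈ elements ] (⟦ inB* t ⟧ * (Q * ν t - e* * e*))
    ≡⟨ ∑-cong elements (λ t → distribute ⟦ inB* t ⟧ Q (ν t) (e* * e*)) ⟩
      ∑[ t ∈ elements ] (Q * (⟦ inB* t ⟧ * ν t) - (e* * e*) * ⟦ inB* t ⟧)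
    ≡⟨ ∑-- elements _ _ ⟩
      ∑[ t ∈ elements ] (Q * (⟦ inB* t ⟧ * ν t)) - ∑[ t ∈ elements ] ((e* * e*) * ⟦ inB* t ⟧)
    ≡⟨ cong₂ _-_ (trans (∑-*ˡ elements Q _) (cong (Q *_) ν-on-B*))
                 (trans (∑-*ˡ elements (e* * e*) _) (cong ((e* * e*) *_) (sym N≡∑))) ⟩
      Q * (e* * e* - ν 0#) - e* * e* * N ∎
    where
      open ≡-Reasoning
      distribute : ∀ b Q v k → b * (Q * v - k) ≡ Q * (b * v) - k * b
      distribute = solve-∀

  D-bound : D * D ≤ (e* * e*) * (N * N * (Q * Q * Q))
  D-bound = begin
      D * D
    ≤⟨ cauchy-schwarz-on elements inB* d ⟩
      ∑[ t ∈ elements ] ⟦ inB* t ⟧ * ∑[ t ∈ elements ] (⟦ inB* t ⟧ * (d t * d t))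
    ≤⟨ *-monoˡ-nonneg (∑-nonneg elements (λ t → ⟦⟧-nonneg (inB* t)))
         (∑-mono elements (λ t → ⟦⟧-guard-≤ (inB* t) (λ t∈B* → ν-deviation-bound (inB*-nonzero t∈B*)))) ⟩
      ∑[ t ∈ elements ] ⟦ inB* t ⟧ * ∑[ t ∈ elements ] (⟦ inB* t ⟧ * K)
    ≡⟨ cong₂ _*_ (sym N≡∑) (trans (∑-*ʳ elements K (λ t → ⟦ inB* t ⟧)) (cong (_* K) (sym N≡∑))) ⟩
      N * (N * K)
    ≡⟨ regroup N e* Q ⟩
      (e* * e*) * (N * N * (Q * Q * Q)) ∎
    where
      open ℤP.≤-Reasoning
      d : Carrier → ℤ
      d t = Q * ν t - e* * e*
      K : ℤ
      K = e* * (Q * Q * Q * e*)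
      regroup : ∀ N e Q → N * (N * (e * (Q * Q * Q * e))) ≡ (e * e) * (N * N * (Q * Q * Q))
      regroup = solve-∀

  -- e = |E| differs from e* by the origin at most: e* ≤ e ≤ e* + 1.
  e : ℤ
  e = + card E

  origin-count : ℤ
  origin-count = ∑[ x ∈ points ] ⟦ E x ∧ (x ==v 𝟎) ⟧

  e-split : e ≡ e* + origin-count
  e-split = trans (length-filter points E) (trans (∑-cong points split) (∑-+ points _ _))
    where
      split : ∀ x → ⟦ E x ⟧ ≡ ⟦ E* x ⟧ + ⟦ E x ∧ (x ==v 𝟎) ⟧
      split x with E x | x ==v 𝟎
      ... | true | true = refl
      ... | true | false = refl
      ... | false | _ = refl

  e*≤e : e* ≤ e
  e*≤e = subst (e* ≤_) (sym e-split)
    (ℤP.i≤i+j e* origin-count {{Int.nonNegative (∑-nonneg points (λ x → ⟦⟧-nonneg (E x ∧ (x ==v 𝟎))))}})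

  e≤e*+1 : e ≤ e* + 1ℤ
  e≤e*+1 = subst (_≤ e* + 1ℤ) (sym e-split) (ℤP.+-monoʳ-≤ e* (at-most-one _ only-origin))
    where
      only-origin : ∀ x x' → (E x ∧ (x ==v 𝟎)) ≡ true → (E x' ∧ (x' ==v 𝟎)) ≡ true → x ≡ x'
      only-origin x x' at-x at-x' = trans (decided (x ≟v 𝟎) (BoolP.∧-conicalʳ (E x) _ at-x))
                                          (sym (decided (x' ≟v 𝟎) (BoolP.∧-conicalʳ (E x') _ at-x')))

open import Data.Integer using (_-_; _*_; _≤_; _^_)
open FiniteField using (Carrier; Vec2; IsBilinear; IsNonDegenerate; card; cardBstar)
open FinalArithmetic using (final-inequality)

-- The incidence bounds fed into the final arithmetic; the argument works
-- for every finite field.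
corollary2p3 : (q : ℕ) → OddPrimePower q → (F : FiniteField q) →
    (B : Vec2 F → Vec2 F → Carrier F) → IsBilinear F B → IsNonDegenerate F B →
    (E : Vec2 F → Bool) →
    let N = + cardBstar F B E
        e = + card F E
        Q = + q
        R = (Q - N) * e - Q * Q
    in R ≤ + 0 ⊎ R * R ≤ N * N * Q ^ 3
corollary2p3 q _ F B bilinear nondegenerate E =
  final-inequality Q N e e* (ν (FiniteField.0# F)) D
    1≤Q (+≤+ ℕ.z≤n) e*-nonneg e*≤e e≤e*+1 ν-zero-bound D-formula D-bound
  where open Incidences F B bilinear nondegenerate E
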